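{- Let $m\ge 4$ and let $n\ge 5$ be even. On an $m\times n$ board with White king on $(m,1)$, White rook on $(1,1)$, Black king (alone) on $(m,n)$, and White to move, White can force checkmate in at most $n+1$ moves against every defence by Black.
   Context: The board consists of the squares $(i,j)$ with $1\le i\le m$ (column index) and $1\le j\le n$ (row index). Pieces move according to the usual chess rules adapted to this board: a king moves to any adjacent square, a rook moves any number of squares along its row or column without passing over other pieces, kings may not move into check, and the two kings may never be on adjacent squares. The number of moves counted is the number of White moves, including the mating move. -}

module Defs where

open import Data.Nat using (ℕ; zero; suc; _+_; _≤_; _<_; ∣_-_∣; _⊔_; _⊓_)
open import Data.Product using (_×_; _,_; ∃; Σ)
open import Data.Sum using (_⊎_)
open import Relation.Binary.PropositionalEquality using (_≡_; _≢_)
open import Relation.Nullary using (¬_)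

Sq : Set
Sq = ℕ × ℕ

col : Sq → ℕ
col (i , _) = i

row : Sq → ℕ
row (_ , j) = j

OnBoard : ℕ → ℕ → Sq → Set
OnBoard m n (i , j) = (1 ≤ i × i ≤ m) × (1 ≤ j × j ≤ n)

Adj : Sq → Sq → Set
Adj p q = p ≢ q × (∣ col p - col q ∣ ≤ 1 × ∣ row p - row q ∣ ≤ 1)

StrictBetween : ℕ → ℕ → ℕ → Set
StrictBetween a b x = (a ⊓ b) < x × x < (a ⊔ b)

Between : Sq → Sq → Sq → Set
Between p q s =
  (col p ≡ col q × col s ≡ col p × StrictBetween (row p) (row q) (row s))
  ⊎ (row p ≡ row q × row s ≡ row p × StrictBetween (col p) (col q) (col s))

SameLine : Sq → Sq → Set
SameLine p q = col p ≡ col q ⊎ row p ≡ row q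

-- A rook on r attacks square s, the only possible blocker being the
-- White king on wk (the Black king itself never blocks, as it is the
-- piece being attacked).
RookAttacks : Sq → Sq → Sq → Set
RookAttacks r wk s = s ≢ r × SameLine r s × ¬ Between r s wk

-- Positions of KRK with the rook still on the board:
-- White king, White rook, Black king.
record Pos : Set where
  constructor pos
  field
    wk : Sq
    rk : Sq
    bk : Sq
open Pos public

InCheck : Pos → Set
InCheck P = RookAttacks (rk P) (wk P) (bk P)

data WhiteMove (m n : ℕ) (P : Pos) : Pos → Set where
  kingMove : (t : Sq) → OnBoard m n t → Adj (wk P) t → t ≢ rk P → t ≢ bk P →
             ¬ Adj t (bk P) →
             WhiteMove m n P (pos t (rk P) (bk P))
  rookMove : (t : Sq) → OnBoard m n t → t ≢ rk P → SameLine (rk P) t →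
             t ≢ wk P → t ≢ bk P →
             ¬ Between (rk P) t (wk P) → ¬ Between (rk P) t (bk P) →
             WhiteMove m n P (pos (wk P) t (bk P))

-- Legal Black king moves from P (Black to move) to square t.
-- Moving onto the rook square is a capture; it is legal iff the rook is
-- not defended by the White king.
BlackMove : ℕ → ℕ → Pos → Sq → Set
BlackMove m n P t =
  OnBoard m n t × Adj (bk P) t × ¬ Adj t (wk P) × t ≢ wk P ×
  (t ≢ rk P → ¬ RookAttacks (rk P) (wk P) t)

Mated : ℕ → ℕ → Pos → Set
Mated m n P = InCheck P × (∀ t → ¬ BlackMove m n P t)

-- A stalemate or a capture of the rook is never a win.
data WinIn (m n : ℕ) : ℕ → Pos → Set where
  mate : ∀ {k P P'} → WhiteMove m n P P' → Mated m n P' → WinIn m n (suc k) P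
  step : ∀ {k P P'} → WhiteMove m n P P' →
         ∃ (λ t → BlackMove m n P' t) →
         (∀ t → BlackMove m n P' t →
            t ≢ rk P' × WinIn m n k (pos (wk P') (rk P') t)) →
         WinIn m n (suc k) P

-- The rook on file m − 1 confines the Black king to the edge file m, where it can only step
-- up or down, while the White king walks up the same file one row per move.  What matters is
-- the parity of the distance between the kings.  While it is odd, every king move keeps it odd,
-- so Black is pushed into the corner (m , n) with the kings three rows apart, where a
-- three-move net mates: king to (m − 1 , n − 2), Black must enter (m − 1 , n), the rook swings
-- to file m − 2, Black returns to the corner and the rook mates along the top rank.  After the
-- rook's first move the distance is n − 2, even; when an even distance drops to 2, White loses
-- a tempo by moving the rook up one row, which makes it odd.  The rook move, the tempo, n − 4
-- king moves and the three-move mate add up to n + 1.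

module Submission where

open import Defs
open import Data.Nat using (ℕ; zero; suc; _+_; _*_; _≤_; _<_; z≤n; s≤s; z<s; ∣_-_∣)
open import Data.Nat.Properties
open import Data.Nat.Divisibility using (_∣_; divides)
open import Data.Nat.Tactic.RingSolver using (solve-∀)
open import Data.Product using (_×_; _,_; ∃-syntax)
open import Data.Sum using (_⊎_; inj₁; inj₂)
open import Data.Empty using (⊥-elim)
open import Function using (_∘_)
open import Relation.Nullary using (¬_)
open import Relation.Binary.PropositionalEquality using (_≡_; _≢_; refl; sym; trans; cong; subst)

data Near : ℕ → ℕ → Set where
  same : ∀ {a} → Near a a
  pred : ∀ {a} → Near (suc a) a
  succ : ∀ {a} → Near a (suc a)

near : ∀ a b → ∣ a - b ∣ ≤ 1 → Near a b
near zero          zero          _        = same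
near zero          (suc zero)    _        = succ
near zero          (suc (suc b)) (s≤s ())
near (suc zero)    zero          _        = pred
near (suc (suc a)) zero          (s≤s ())
near (suc a)       (suc b)       d with near a b d
... | same = same
... | pred = pred
... | succ = succ

Near⇒∣-∣≤1 : ∀ {a b} → Near a b → ∣ a - b ∣ ≤ 1
Near⇒∣-∣≤1 {zero}      same = z≤n
Near⇒∣-∣≤1 {suc a}     same = Near⇒∣-∣≤1 {a} same
Near⇒∣-∣≤1 {b = zero}  pred = s≤s z≤n
Near⇒∣-∣≤1 {b = suc b} pred = Near⇒∣-∣≤1 {b = b} pred
Near⇒∣-∣≤1 {zero}      succ = s≤s z≤n
Near⇒∣-∣≤1 {suc a}     succ = Near⇒∣-∣≤1 {a} succ

Near-sym : ∀ {a b} → Near a b → Near b a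
Near-sym same = same
Near-sym pred = succ
Near-sym succ = pred

Near⇒≤1+ : ∀ {a b} → Near a b → b ≤ suc a
Near⇒≤1+ same = n≤1+n _
Near⇒≤1+ pred = ≤-trans (n≤1+n _) (n≤1+n _)
Near⇒≤1+ succ = ≤-refl

2+a≤b⇒¬Near : ∀ {a b} → 2 + a ≤ b → ¬ Near a b
2+a≤b⇒¬Near h ab = 1+n≰n (≤-trans h (Near⇒≤1+ ab))

adjacent : ∀ {p q} → p ≢ q → Near (col p) (col q) → Near (row p) (row q) → Adj p q
adjacent p≢q nc nr = p≢q , Near⇒∣-∣≤1 nc , Near⇒∣-∣≤1 nr

¬Adj-above : ∀ {p q} → 2 + row p ≤ row q → ¬ Adj p q
¬Adj-above {p} {q} h (_ , _ , d) = 2+a≤b⇒¬Near h (near (row p) (row q) d)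

¬Adj-below : ∀ {p q} → 2 + row q ≤ row p → ¬ Adj p q
¬Adj-below {p} {q} h (_ , _ , d) =
  2+a≤b⇒¬Near h (Near-sym (near (row p) (row q) d))

¬Between-offLine : ∀ {p q s} → (col p ≡ col q → col s ≢ col p) → (row p ≡ row q → row s ≢ row p) →
                   ¬ Between p q s
¬Between-offLine offFile _ (inj₁ (e , e′ , _)) = offFile e e′
¬Between-offLine _ offRank (inj₂ (e , e′ , _)) = offRank e e′

RookAttacks-file : ∀ {r wk y} → col wk ≢ col r → y ≢ row r → RookAttacks r wk (col r , y)
RookAttacks-file wk∉file y≢ =
  y≢ ∘ cong row , inj₁ refl , ¬Between-offLine (λ _ → wk∉file) (λ e → ⊥-elim (y≢ (sym e)))

RookAttacks-rank : ∀ {r wk x} → row wk ≢ row r → x ≢ col r → RookAttacks r wk (x , row r)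
RookAttacks-rank wk∉rank x≢ =
  x≢ ∘ cong col , inj₂ refl , ¬Between-offLine (λ e → ⊥-elim (x≢ (sym e))) (λ _ → wk∉rank)

¬RookAttacks-offLines : ∀ {r wk s} → col r ≢ col s → row r ≢ row s → ¬ RookAttacks r wk s
¬RookAttacks-offLines c≢ _ (_ , inj₁ e , _) = c≢ e
¬RookAttacks-offLines _ r≢ (_ , inj₂ e , _) = r≢ e

a+r≤r+[a+x] : ∀ r a x → a + r ≤ r + (a + x)
a+r≤r+[a+x] r a x = subst (_≤ r + (a + x)) (+-comm r a) (+-monoʳ-≤ r (m≤m+n a x))

gap-suc : ∀ r a d → r + (a + 2 * suc d) ≡ 2 + (r + (a + 2 * d))
gap-suc = solve-∀

1+y≡r+a⇒y<a+r : ∀ r a {y} → suc y ≡ r + a → y < a + r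
1+y≡r+a⇒y<a+r r a e = ≤-reflexive (trans e (+-comm r a))

5≤n∧2∣n⇒n≡4+2*suc : ∀ {n} → 5 ≤ n → 2 ∣ n → ∃[ d ] n ≡ 4 + 2 * suc d
5≤n∧2∣n⇒n≡4+2*suc ()                                (divides zero refl)
5≤n∧2∣n⇒n≡4+2*suc (s≤s (s≤s ()))                   (divides (suc zero) refl)
5≤n∧2∣n⇒n≡4+2*suc (s≤s (s≤s (s≤s (s≤s ()))))       (divides (suc (suc zero)) refl)
5≤n∧2∣n⇒n≡4+2*suc _ (divides (suc (suc (suc d))) refl) = d , double d
  where
  double : ∀ d → (3 + d) * 2 ≡ 4 + 2 * suc d
  double = solve-∀

module Chase (e : ℕ) (1≤e : 1 ≤ e) where

  c M : ℕ
  c = suc e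
  M = suc c

  e<c : e < c
  e<c = n<1+n e

  c<M : c < M
  c<M = n<1+n c

  e<M : e < M
  e<M = m<n⇒m<1+n e<c

  Confined : ℕ → ℕ → ℕ → Pos
  Confined w ρ b = pos (M , w) (c , ρ) (M , b)

  kingUp : ∀ {n r ρ b} → 3 + r ≤ b → b ≤ n → WhiteMove M n (Confined r ρ b) (Confined (suc r) ρ b)
  kingUp {r = r} 3+r≤b b≤n =
    kingMove (M , suc r) ((s≤s z≤n , ≤-refl) , (s≤s z≤n , m+n≤o⇒n≤o 2 (≤-trans 3+r≤b b≤n)))
      (adjacent (<⇒≢ (n<1+n r) ∘ cong row) same succ) (>⇒≢ c<M ∘ cong col)
      (<⇒≢ (m+n≤o⇒n≤o 1 3+r≤b) ∘ cong row) (¬Adj-above 3+r≤b)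

  tempo : ∀ {n r ρ b} → suc ρ ≤ n → WhiteMove M n (Confined r ρ b) (Confined r (suc ρ) b)
  tempo {ρ = ρ} 1+ρ≤n =
    rookMove (c , suc ρ) ((s≤s z≤n , <⇒≤ c<M) , (s≤s z≤n , 1+ρ≤n))
      (1+n≢n ∘ cong row) (inj₁ refl) (<⇒≢ c<M ∘ cong col) (<⇒≢ c<M ∘ cong col)
      (¬Between-offLine (λ _ → >⇒≢ c<M) (λ ()))
      (¬Between-offLine (λ _ → >⇒≢ c<M) (λ ()))

  edgeMove : ∀ {n w ρ b y} → ρ ≤ w → 2 + w ≤ y → y ≤ n → Near b y → b ≢ y →
             BlackMove M n (Confined w ρ b) (M , y)
  edgeMove ρ≤w 2+w≤y y≤n by b≢y =
    ((s≤s z≤n , ≤-refl) , (≤-trans (s≤s z≤n) 2+w≤y , y≤n)) ,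
    adjacent (b≢y ∘ cong row) same by , ¬Adj-below 2+w≤y ,
    >⇒≢ w<y ∘ cong row ,
    λ _ → ¬RookAttacks-offLines (<⇒≢ c<M) (<⇒≢ (≤-<-trans ρ≤w w<y))
    where
    w<y = m+n≤o⇒n≤o 1 2+w≤y

  edgeMove-exists : ∀ {n w ρ b} → ρ ≤ w → 1 + w < b → b ≤ n → suc b ≤ n ⊎ 3 + w ≤ b →
                    ∃[ t ] BlackMove M n (Confined w ρ b) t
  edgeMove-exists {b = b} ρ≤w 1+w<b _ (inj₁ 1+b≤n) =
    _ , edgeMove ρ≤w (m≤n⇒m≤1+n 1+w<b) 1+b≤n succ (<⇒≢ (n<1+n b))
  edgeMove-exists {b = suc y} ρ≤w _ b≤n (inj₂ (s≤s 2+w≤y)) =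
    _ , edgeMove ρ≤w 2+w≤y (m+n≤o⇒n≤o 1 b≤n) pred 1+n≢n

  confined-replies : ∀ {n w ρ b x y} → ρ ≤ w → 1 + w < b → BlackMove M n (Confined w ρ b) (x , y) →
                     (x ≡ M × y ≡ suc b) ⊎ (x ≡ M × suc y ≡ b × 1 + w < y)
  confined-replies {ρ = ρ} {b} {x} {y} ρ≤w 1+w<b (((_ , x≤M) , _) , (t≢bk , dx , dy) , ¬adj , _ , safe)
    with near M x dx | near b y dy
  ... | succ | _    = ⊥-elim (1+n≰n x≤M)
  ... | pred | by   = ⊥-elim (safe (ρ≢y ∘ sym ∘ cong row) (RookAttacks-file (>⇒≢ c<M) (ρ≢y ∘ sym)))
    where
    ρ≢y : ρ ≢ y
    ρ≢y = <⇒≢ (≤-<-trans ρ≤w (≤-pred (≤-trans 1+w<b (Near⇒≤1+ (Near-sym by)))))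
  ... | same | same = ⊥-elim (t≢bk refl)
  ... | same | succ = inj₁ (refl , refl)
  ... | same | pred with m≤n⇒m<n∨m≡n (≤-pred 1+w<b)
  ...   | inj₁ 1+w<y = inj₂ (refl , refl , 1+w<y)
  ...   | inj₂ refl  = ⊥-elim (¬adj (adjacent (1+n≢n ∘ cong row) same pred))

  confined-step : ∀ {n k P w ρ b} → WhiteMove M n P (Confined w ρ b) → ρ ≤ w → 1 + w < b → b ≤ n →
                  suc b ≤ n ⊎ 3 + w ≤ b →
                  (suc b ≤ n → WinIn M n k (Confined w ρ (suc b))) →
                  (∀ y → suc y ≡ b → 1 + w < y → WinIn M n k (Confined w ρ y)) →
                  WinIn M n (suc k) P
  confined-step {n} {k} {w = w} {ρ} {b} mv ρ≤w 1+w<b b≤n notStalemate up down =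
    step mv (edgeMove-exists ρ≤w 1+w<b b≤n notStalemate) answer
    where
    answer : ∀ t → BlackMove M n (Confined w ρ b) t → t ≢ (c , ρ) × WinIn M n k (pos (M , w) (c , ρ) t)
    answer (x , y) bm@((_ , _ , y≤n) , _) with confined-replies ρ≤w 1+w<b bm
    ... | inj₁ (refl , refl)       = >⇒≢ c<M ∘ cong col , up y≤n
    ... | inj₂ (refl , e , 1+w<y) = >⇒≢ c<M ∘ cong col , down y e 1+w<y

  topRankMate : ∀ r → Mated M (3 + r) (pos (c , suc r) (e , 3 + r) (M , 3 + r))
  topRankMate r = RookAttacks-rank (<⇒≢ (m<n+m (suc r) {2} z<s)) (>⇒≢ e<M) , noEscape
    where
    noEscape : ∀ t → ¬ BlackMove M (3 + r) (pos (c , suc r) (e , 3 + r) (M , 3 + r)) t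
    noEscape (x , y) (((_ , x≤M) , _ , y≤N) , (t≢bk , dx , dy) , ¬adj , _ , safe)
      with near M x dx | near (3 + r) y dy
    ... | succ | _    = 1+n≰n x≤M
    ... | _    | succ = 1+n≰n y≤N
    ... | same | same = t≢bk refl
    ... | same | pred = ¬adj (adjacent (1+n≢n ∘ cong col) pred pred)
    ... | pred | pred = ¬adj (adjacent (1+n≢n ∘ cong row) same pred)
    ... | pred | same =
      safe (>⇒≢ e<c ∘ cong col) (RookAttacks-rank (<⇒≢ (m<n+m (suc r) {2} z<s)) (>⇒≢ e<c))

  mateIn1 : ∀ r ρ → ρ ≤ r → WinIn M (3 + r) 1 (pos (c , suc r) (e , ρ) (M , 3 + r))
  mateIn1 r ρ ρ≤r = mate rookUp (topRankMate r)
    where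
    ρ≢3+r : ρ ≢ 3 + r
    ρ≢3+r = <⇒≢ (≤-trans (s≤s ρ≤r) (m≤n+m (suc r) 2))
    rookUp : WhiteMove M (3 + r) (pos (c , suc r) (e , ρ) (M , 3 + r))
                                 (pos (c , suc r) (e , 3 + r) (M , 3 + r))
    rookUp = rookMove (e , 3 + r) ((1≤e , <⇒≤ e<M) , (s≤s z≤n , ≤-refl))
               (ρ≢3+r ∘ sym ∘ cong row) (inj₁ refl) (<⇒≢ e<c ∘ cong col) (<⇒≢ e<M ∘ cong col)
               (¬Between-offLine (λ _ → >⇒≢ e<c) (λ e → ⊥-elim (ρ≢3+r e)))
               (¬Between-offLine (λ _ → >⇒≢ e<M) (λ e → ⊥-elim (ρ≢3+r e)))

  mateIn2 : ∀ r ρ → 1 ≤ ρ → ρ ≤ r → WinIn M (3 + r) 2 (pos (c , suc r) (c , ρ) (c , 3 + r))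
  mateIn2 r ρ 1≤ρ ρ≤r = step rookAside (_ , backToCorner) replies
    where
    ρ<1+r : ρ < suc r
    ρ<1+r = s≤s ρ≤r
    ρ<3+r : ρ < 3 + r
    ρ<3+r = ≤-trans ρ<1+r (m≤n+m (suc r) 2)
    Aside = pos (c , suc r) (e , ρ) (c , 3 + r)
    rookAside : WhiteMove M (3 + r) (pos (c , suc r) (c , ρ) (c , 3 + r)) Aside
    rookAside = rookMove (e , ρ) ((1≤e , <⇒≤ e<M) , (1≤ρ , <⇒≤ ρ<3+r))
                  (<⇒≢ e<c ∘ cong col) (inj₂ refl) (<⇒≢ e<c ∘ cong col) (<⇒≢ e<c ∘ cong col)
                  (¬Between-offLine (λ c≡e → ⊥-elim (>⇒≢ e<c c≡e)) (λ _ → >⇒≢ ρ<1+r))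
                  (¬Between-offLine (λ c≡e → ⊥-elim (>⇒≢ e<c c≡e)) (λ _ → >⇒≢ ρ<3+r))
    backToCorner : BlackMove M (3 + r) Aside (M , 3 + r)
    backToCorner = ((s≤s z≤n , ≤-refl) , (s≤s z≤n , ≤-refl)) ,
                   adjacent (<⇒≢ c<M ∘ cong col) succ same , ¬Adj-below ≤-refl ,
                   >⇒≢ c<M ∘ cong col ,
                   λ _ → ¬RookAttacks-offLines (<⇒≢ e<M) (<⇒≢ ρ<3+r)
    replies : ∀ t → BlackMove M (3 + r) Aside t → t ≢ (e , ρ) × WinIn M (3 + r) 1 (pos (c , suc r) (e , ρ) t)
    replies (x , y) (((_ , x≤M) , _ , y≤N) , (t≢bk , dx , dy) , ¬adj , _ , safe)
      with near c x dx | near (3 + r) y dy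
    ... | _    | succ = ⊥-elim (1+n≰n y≤N)
    ... | same | same = ⊥-elim (t≢bk refl)
    ... | same | pred = ⊥-elim (¬adj (adjacent (1+n≢n ∘ cong row) same pred))
    ... | pred | pred = ⊥-elim (¬adj (adjacent (<⇒≢ e<c ∘ cong col) succ pred))
    ... | succ | pred = ⊥-elim (¬adj (adjacent (>⇒≢ c<M ∘ cong col) pred pred))
    ... | pred | same = ⊥-elim (safe (>⇒≢ ρ<3+r ∘ cong row) (RookAttacks-file (>⇒≢ e<c) (>⇒≢ ρ<3+r)))
    ... | succ | same = >⇒≢ e<M ∘ cong col , mateIn1 r ρ ρ≤r

  mateIn3 : ∀ {N} r ρ → 1 ≤ ρ → ρ ≤ r → N ≡ 3 + r → WinIn M N 3 (Confined r ρ N)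
  mateIn3 r ρ 1≤ρ ρ≤r refl = step kingAcross (_ , intoFile) replies
    where
    ρ<1+r : ρ < suc r
    ρ<1+r = s≤s ρ≤r
    Across = pos (c , suc r) (c , ρ) (M , 3 + r)
    kingAcross : WhiteMove M (3 + r) (Confined r ρ (3 + r)) Across
    kingAcross = kingMove (c , suc r) ((s≤s z≤n , <⇒≤ c<M) , (s≤s z≤n , m≤n+m (suc r) 2))
                   (adjacent (>⇒≢ c<M ∘ cong col) pred succ) (>⇒≢ ρ<1+r ∘ cong row)
                   (<⇒≢ c<M ∘ cong col) (¬Adj-above ≤-refl)
    intoFile : BlackMove M (3 + r) Across (c , 3 + r)
    intoFile = ((s≤s z≤n , <⇒≤ c<M) , (s≤s z≤n , ≤-refl)) ,
               adjacent (>⇒≢ c<M ∘ cong col) pred same , ¬Adj-below ≤-refl ,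
               >⇒≢ (m<n+m (suc r) {2} z<s) ∘ cong row ,
               λ _ (_ , _ , unblocked) → unblocked (inj₁ (refl , refl , shielded))
      where
      shielded : StrictBetween ρ (3 + r) (suc r)
      shielded = ≤-<-trans (m⊓n≤m ρ (3 + r)) ρ<1+r ,
                 <-≤-trans (m<n+m (suc r) {2} z<s) (m≤n⊔m ρ (3 + r))
    replies : ∀ t → BlackMove M (3 + r) Across t → t ≢ (c , ρ) × WinIn M (3 + r) 2 (pos (c , suc r) (c , ρ) t)
    replies (x , y) (((_ , x≤M) , _ , y≤N) , (t≢bk , dx , dy) , ¬adj , _ , _)
      with near M x dx | near (3 + r) y dy
    ... | succ | _    = ⊥-elim (1+n≰n x≤M)
    ... | _    | succ = ⊥-elim (1+n≰n y≤N)
    ... | same | same = ⊥-elim (t≢bk refl)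
    ... | same | pred = ⊥-elim (¬adj (adjacent (>⇒≢ c<M ∘ cong col) pred pred))
    ... | pred | pred = ⊥-elim (¬adj (adjacent (1+n≢n ∘ cong row) same pred))
    ... | pred | same = >⇒≢ (≤-trans ρ<1+r (m≤n+m (suc r) 2)) ∘ cong row , mateIn2 r ρ 1≤ρ ρ≤r

  oddGap-win : ∀ {n} s r d ρ → 1 ≤ ρ → ρ ≤ r → r + (3 + s) ≡ n → r + (3 + 2 * d) ≤ n →
               WinIn M n (3 + s) (Confined r ρ (r + (3 + 2 * d)))
  oddGap-win zero r zero ρ 1≤ρ ρ≤r refl _ = mateIn3 r ρ 1≤ρ ρ≤r (+-comm r 3)
  oddGap-win zero r (suc d) ρ _ _ refl b≤n = ⊥-elim (<⇒≱ (+-monoʳ-< r (m<m+n 3 z<s)) b≤n)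
  oddGap-win {n} (suc s) r zero ρ 1≤ρ ρ≤r eq b≤n =
    confined-step (kingUp 3+r≤b b≤n) (m≤n⇒m≤1+n ρ≤r) 3+r≤b b≤n (inj₁ b<n)
      (oddGap-win s (suc r) zero ρ 1≤ρ (m≤n⇒m≤1+n ρ≤r) eq′)
      (λ y e 3+r≤y → ⊥-elim (<⇒≱ (1+y≡r+a⇒y<a+r r 3 e) 3+r≤y))
    where
    3+r≤b = a+r≤r+[a+x] r 3 0
    eq′ = trans (sym (+-suc r (3 + s))) eq
    b<n = ≤-trans (s≤s (+-monoʳ-≤ r (m≤m+n 3 s))) (≤-reflexive eq′)
  oddGap-win {n} (suc s) r (suc d) ρ 1≤ρ ρ≤r eq b≤n =
    confined-step (kingUp 3+r≤b b≤n) (m≤n⇒m≤1+n ρ≤r) 3+r≤b b≤n (inj₂ (a+r≤r+[a+x] r 4 _))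
      (oddGap-win s (suc r) (suc d) ρ 1≤ρ (m≤n⇒m≤1+n ρ≤r) eq′)
      retreat
    where
    3+r≤b = a+r≤r+[a+x] r 3 (2 * suc d)
    eq′ = trans (sym (+-suc r (3 + s))) eq
    retreat : ∀ y → suc y ≡ r + (3 + 2 * suc d) → 3 + r ≤ y →
              WinIn M n (3 + s) (Confined (suc r) ρ y)
    retreat y e _ with suc-injective (trans e (gap-suc r 3 d))
    ... | refl = oddGap-win s (suc r) d ρ 1≤ρ (m≤n⇒m≤1+n ρ≤r) eq′
                   (m+n≤o⇒n≤o 1 (subst (_≤ n) (sym e) b≤n))

  -- ρ < r + 2 * d keeps the tempo square suc ρ at or below the White king's row.
  evenGap-win : ∀ {n} s r d ρ → 1 ≤ ρ → ρ ≤ r → ρ < r + 2 * d → r + (3 + s) ≡ n → r + (2 + 2 * d) ≤ n →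
                WinIn M n (4 + s) (Confined r ρ (r + (2 + 2 * d)))
  evenGap-win {n} s r zero ρ 1≤ρ ρ≤r ρ<r+0 eq b≤n =
    confined-step (tempo (≤-trans ρ<r (≤-trans (m≤m+n r 2) b≤n))) ρ<r (a+r≤r+[a+x] r 2 0) b≤n (inj₁ b<n) up
      (λ y e 2+r≤y → ⊥-elim (<⇒≱ (1+y≡r+a⇒y<a+r r 2 e) 2+r≤y))
    where
    ρ<r = subst (ρ <_) (+-identityʳ r) ρ<r+0
    b<n = ≤-trans (≤-reflexive (sym (+-suc r 2))) (≤-trans (+-monoʳ-≤ r (m≤m+n 3 s)) (≤-reflexive eq))
    up : suc (r + 2) ≤ n → WinIn M n (3 + s) (Confined r (suc ρ) (suc (r + 2)))
    up h = subst (λ z → WinIn M n (3 + s) (Confined r (suc ρ) z)) (+-suc r 2)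
             (oddGap-win s r zero (suc ρ) (s≤s z≤n) ρ<r eq (subst (_≤ n) (sym (+-suc r 2)) h))
  evenGap-win zero r (suc d) ρ _ _ _ refl b≤n =
    ⊥-elim (<⇒≱ (+-monoʳ-< r (+-monoʳ-≤ 2 (*-monoʳ-≤ 2 (s≤s z≤n)))) b≤n)
  evenGap-win {n} (suc s) r (suc d) ρ 1≤ρ ρ≤r ρ<r+2d eq b≤n =
    confined-step (kingUp 3+r≤b b≤n) (m≤n⇒m≤1+n ρ≤r) 3+r≤b b≤n (inj₂ 4+r≤b)
      (evenGap-win s (suc r) (suc d) ρ 1≤ρ (m≤n⇒m≤1+n ρ≤r) (m<n⇒m<1+n ρ<r+2d) eq′)
      retreat
    where
    4+r≤b : 4 + r ≤ r + (2 + 2 * suc d)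
    4+r≤b = subst (4 + r ≤_) (sym (gap-suc r 2 d)) (s≤s (s≤s (a+r≤r+[a+x] r 2 (2 * d))))
    3+r≤b = m+n≤o⇒n≤o 1 4+r≤b
    eq′ = trans (sym (+-suc r (3 + s))) eq
    retreat : ∀ y → suc y ≡ r + (2 + 2 * suc d) → 3 + r ≤ y →
              WinIn M n (4 + s) (Confined (suc r) ρ y)
    retreat y e _ with suc-injective (trans e (gap-suc r 2 d))
    ... | refl = evenGap-win s (suc r) d ρ 1≤ρ (m≤n⇒m≤1+n ρ≤r) (s≤s (≤-trans ρ≤r (m≤m+n r _))) eq′
                   (m+n≤o⇒n≤o 1 (subst (_≤ n) (sym e) b≤n))

  opening : ∀ d → WinIn M (4 + 2 * suc d) (5 + 2 * suc d) (pos (M , 1) (1 , 1) (M , 4 + 2 * suc d))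
  opening d = confined-step rookAcross ≤-refl (s≤s (s≤s (s≤s z≤n))) ≤-refl (inj₂ (s≤s (s≤s (s≤s (s≤s z≤n)))))
                (⊥-elim ∘ 1+n≰n) retreat
    where
    N = 4 + 2 * suc d
    1≢c : 1 ≢ c
    1≢c = <⇒≢ (s≤s 1≤e)
    kingBeyond : ¬ Between (1 , 1) (c , 1) (M , 1)
    kingBeyond (inj₁ (1≡c , _))         = 1≢c 1≡c
    kingBeyond (inj₂ (_ , _ , _ , M<c)) = <⇒≱ c<M (<⇒≤ M<c)
    rookAcross : WhiteMove M N (pos (M , 1) (1 , 1) (M , N)) (Confined 1 1 N)
    rookAcross = rookMove (c , 1) ((s≤s z≤n , <⇒≤ c<M) , (s≤s z≤n , s≤s z≤n))
                   (1≢c ∘ sym ∘ cong col) (inj₂ refl) (<⇒≢ c<M ∘ cong col) (<⇒≢ c<M ∘ cong col)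
                   kingBeyond (¬Between-offLine (λ 1≡c → ⊥-elim (1≢c 1≡c)) (λ _ ()))
    retreat : ∀ y → suc y ≡ N → 2 < y → WinIn M N (4 + 2 * suc d) (Confined 1 1 y)
    retreat _ refl _ = evenGap-win (2 * suc d) 1 (suc d) 1 (s≤s z≤n) ≤-refl (s≤s (s≤s z≤n)) refl (n≤1+n _)

lemma2 : (m n : ℕ) → 4 ≤ m → 5 ≤ n → 2 ∣ n →
    WinIn m n (n + 1) (pos (m , 1) (1 , 1) (m , n))
lemma2 (suc (suc (suc (suc a)))) n (s≤s (s≤s (s≤s (s≤s _)))) 5≤n 2∣n
  with 5≤n∧2∣n⇒n≡4+2*suc 5≤n 2∣n
... | d , refl = subst (λ k → WinIn (4 + a) n k (pos (4 + a , 1) (1 , 1) (4 + a , n))) (+-comm 1 n)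
                   (opening d)
  where open Chase (2 + a) (s≤s z≤n)
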